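{- (1) If $(G,\sigma)$ is antibalanced and $G$ is not bipartite, then $\chi((G,\sigma))=3$ and $\chi_c((G,\sigma))=2$. (2) For every even integer $k\ge 2$ there is a signed graph $(G,\sigma)$ with $\chi((G,\sigma))-1=\chi_c((G,\sigma))=k$.
   Context: Graphs are simple and finite. A signed graph $(G,\sigma)$ is a graph $G$ with a map $\sigma:E(G)\to\{\pm1\}$. A switching at a vertex $v$ negates $\sigma$ on all edges incident to $v$; two signatures are equivalent if one is obtained from the other by a sequence of switchings. $(G,\sigma)$ is antibalanced if it is equivalent to the signed graph on $G$ in which every edge is negative. For $x\in\mathbb{R}$ and $r>0$, $[x]_r\in[0,r)$ is the remainder of $x$ modulo $r$ and $|x|_r=\min\{[x]_r,[-x]_r\}$. For positive integers $k\ge 2d$, a $(k,d)$-coloring of $(G,\sigma)$ is a map $c:V(G)\to\mathbb{Z}_k$ such that $|c(v)-\sigma(e)c(w)|_k\ge d$ for every edge $e=vw$. The circular chromatic number is $\chi_c((G,\sigma))=\inf\{k/d : (G,\sigma)\text{ has a }(k,d)\text{ -coloring}\}$, and the chromatic number $\chi((G,\sigma))$ is the minimum $k$ such that $(G,\sigma)$ has a $(k,1)$-coloring. -}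

module Defs where

open import Data.Nat using (ℕ; zero; suc; _+_; _*_; _∸_; _≤_; _⊓_; _%_)
open import Data.Bool using (Bool; true; false; if_then_else_; _∨_)
open import Data.Fin using (Fin; toℕ; _≟_)
open import Data.List using (List; foldr)
open import Data.Product using (Σ; ∃; _×_; _,_)
open import Data.Integer using (+_)
open import Data.Rational using (ℚ; _/_)
import Data.Rational as ℚ
open import Data.Sign using (Sign; opposite)
import Data.Sign as Sg
open import Relation.Nullary using (¬_)
open import Relation.Nullary.Decidable using (⌊_⌋)
open import Relation.Binary.PropositionalEquality using (_≡_; _≢_)

-- The signature is given on all
-- ordered pairs (symmetric) but only its values on edges matter.
record SignedGraph (n : ℕ) : Set where
  field
    adj        : Fin n → Fin n → Bool
    adj-sym    : ∀ x y → adj x y ≡ adj y x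
    adj-irrefl : ∀ x → adj x x ≡ false
    sig        : Fin n → Fin n → Sign
    sig-sym    : ∀ x y → sig x y ≡ sig y x

open SignedGraph public

Signature : ℕ → Set
Signature n = Fin n → Fin n → Sign

Edge : ∀ {n} → SignedGraph n → Fin n → Fin n → Set
Edge G x y = adj G x y ≡ true

switch : ∀ {n} → Fin n → Signature n → Signature n
switch v σ x y = if ⌊ x ≟ v ⌋ ∨ ⌊ y ≟ v ⌋ then opposite (σ x y) else σ x y

switchAll : ∀ {n} → List (Fin n) → Signature n → Signature n
switchAll vs σ = foldr switch σ vs

Equivalent : ∀ {n} → SignedGraph n → Signature n → Signature n → Set
Equivalent {n} G σ τ =
  Σ (List (Fin n)) λ vs → ∀ x y → Edge G x y → switchAll vs σ x y ≡ τ x y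

Antibalanced : ∀ {n} → SignedGraph n → Set
Antibalanced G = Equivalent G (sig G) (λ _ _ → Sg.-)

Bipartite : ∀ {n} → SignedGraph n → Set
Bipartite {n} G = Σ (Fin n → Bool) λ f → ∀ x y → Edge G x y → f x ≢ f y

-- [x]_k  (remainder mod k; only used with k ≥ 2)
rem : ℕ → ℕ → ℕ
rem x zero    = x
rem x (suc k) = x % suc k

-- |x|_k = min([x]_k, [-x]_k) = min(r, k - r) with r = [x]_k
circNorm : ℕ → ℕ → ℕ
circNorm k x = rem x k ⊓ (k ∸ rem x k)

-- a natural number congruent to a - s·b mod k, for a, b ∈ {0,…,k-1}
diffRep : ℕ → Sign → ℕ → ℕ → ℕ
diffRep k Sg.+ a b = a + (k ∸ b)
diffRep k Sg.- a b = a + b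

IsColoring : ∀ {n} → SignedGraph n → (k d : ℕ) → (Fin n → Fin k) → Set
IsColoring G k d c =
  ∀ x y → Edge G x y → d ≤ circNorm k (diffRep k (sig G x y) (toℕ (c x)) (toℕ (c y)))

HasColoring : ∀ {n} → SignedGraph n → (k d : ℕ) → Set
HasColoring {n} G k d = (1 ≤ d) × (2 * d ≤ k) × Σ (Fin n → Fin k) (IsColoring G k d)

IsChromaticNumber : ∀ {n} → SignedGraph n → ℕ → Set
IsChromaticNumber G m = HasColoring G m 1 × (∀ k → HasColoring G k 1 → m ≤ k)

CircRatio : ∀ {n} → SignedGraph n → ℚ → Set
CircRatio G q = ∃ λ k → ∃ λ d → HasColoring G k (suc d) × q ≡ (+ k) / suc d

IsCircularChromaticNumber : ∀ {n} → SignedGraph n → ℚ → Set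
IsCircularChromaticNumber G q =
  (∀ r → CircRatio G r → q ℚ.≤ r) ×
  (∀ b → (∀ r → CircRatio G r → b ℚ.≤ r) → b ℚ.≤ q)

-- After the switchings that make an antibalanced signature all-negative, colour each vertex a or
-- -a according to whether it was switched an odd number of times: every edge then sees |2a|_K.
-- With K = 3, a = 1 this is a 3-colouring, and with K = 4m+1, a = m a (4m+1, 2m)-colouring, so
-- χ_c ≤ 2 + 1/(2m) for all m, while k ≥ 2d always gives χ_c ≥ 2; a (2,1)-colouring is a bipartition.
--
-- For even k, take a positive k-clique v_i and twins w_i joined to every v_j, negatively exactly to
-- v_i. Pairwise circular distance ≥ d among k points of ℤ_K forces kd ≤ K (the arcs [c_i, c_i + d)
-- are disjoint), so χ_c ≥ k; with k colours the v_i use all of ℤ_k and the twin of the vertex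
-- coloured 0 has no colour left, so χ ≥ k + 1. The colours i + 1 in ℤ_{k+1} and 2i + 1 in ℤ_{2k}
-- give a (k+1, 1)- and a (2k, 2)-colouring; both use that k is even.

module Submission where

open import Defs
open import Data.Bool using (Bool; true; false; not; if_then_else_)
open import Data.Fin as Fin using (Fin; toℕ; fromℕ<; splitAt; join; remQuot; combine)
import Data.Fin.Properties as Fin
open import Data.Integer as ℤ using (+_; -[1+_]; +≤+)
import Data.Integer.Properties as ℤ
open import Data.List using (List; []; _∷_)
open import Data.Nat hiding (_/_)
open import Data.Nat.Divisibility
open import Data.Nat.DivMod hiding (_/_)
open import Data.Nat.Properties
open import Algebra.Properties.CommutativeSemigroup +-commutativeSemigroup using (xy∙z≈xz∙y; interchange)
open import Data.Nat.Tactic.RingSolver using (solve-∀)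
open import Data.Product using (Σ; ∃; _×_; _,_; proj₁; proj₂; uncurry)
open import Data.Rational as ℚ using (_/_; ↥_)
import Data.Rational.Properties as ℚ
import Data.Rational.Unnormalised as ℚᵘ
import Data.Rational.Unnormalised.Properties as ℚᵘ
open import Data.Sign as Sign using (Sign; opposite)
import Data.Sign.Properties as Sign
open import Data.Sum using (_⊎_; inj₁; inj₂; [_,_]′)
open import Function using (_∘_)
open import Relation.Binary.PropositionalEquality
open import Relation.Nullary
open import Relation.Nullary.Decidable using (⌊_⌋)

-- The circular norm

module _ {K : ℕ} .{{_ : NonZero K}} where

  circNorm≡ : ∀ x → circNorm K x ≡ x % K ⊓ (K ∸ x % K)
  circNorm≡ x = cong (λ r → r ⊓ (K ∸ r)) (rem≡% K x)
    where
    rem≡% : ∀ K .{{_ : NonZero K}} x → rem x K ≡ x % K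
    rem≡% (suc _) _ = refl

  ≤-circNorm⁺ : ∀ {d x} → d ≤ x % K → d ≤ K ∸ x % K → d ≤ circNorm K x
  ≤-circNorm⁺ {x = x} h₁ h₂ = subst (_ ≤_) (sym (circNorm≡ x)) (⊓-glb h₁ h₂)

  ≤-circNorm⁻ : ∀ {d x} → d ≤ circNorm K x → d ≤ x % K × d ≤ K ∸ x % K
  ≤-circNorm⁻ {x = x} h = m≤n⊓o⇒m≤n _ _ h′ , m≤n⊓o⇒m≤o _ _ h′
    where h′ = subst (_ ≤_) (circNorm≡ x) h

  circNorm-%≡0 : ∀ {x} → x % K ≡ 0 → circNorm K x ≡ 0
  circNorm-%≡0 {x} x%K≡0 rewrite circNorm≡ x | x%K≡0 = refl

  %≡0⇒¬1≤circNorm : ∀ {x} → x % K ≡ 0 → ¬ 1 ≤ circNorm K x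
  %≡0⇒¬1≤circNorm x%K≡0 1≤|x| with () ← subst (1 ≤_) (circNorm-%≡0 x%K≡0) 1≤|x|

  ¬1≤circNorm[a+[K∸a]] : ∀ {a} → a ≤ K → ¬ 1 ≤ circNorm K (a + (K ∸ a))
  ¬1≤circNorm[a+[K∸a]] a≤K = %≡0⇒¬1≤circNorm (trans (cong (_% K) (m+[n∸m]≡n a≤K)) (n%n≡0 K))

  %≡0⇒≡0⊎≡K : ∀ {x} → x < K + K → x % K ≡ 0 → x ≡ 0 ⊎ x ≡ K
  %≡0⇒≡0⊎≡K {x} x<2K x%K≡0 with x <? K
  ... | yes x<K = inj₁ (trans (sym (m<n⇒m%n≡m x<K)) x%K≡0)
  ... | no x≮K with r , refl ← m≤n⇒∃[o]m+o≡n (≮⇒≥ x≮K) =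
    inj₂ (trans (cong (_+_ K) r≡0) (+-identityʳ K))
    where
    r≡0 : r ≡ 0
    r≡0 = begin
      r             ≡⟨ m<n⇒m%n≡m (+-cancelˡ-< K r K x<2K) ⟨
      r % K         ≡⟨ %-remove-+ˡ r (n∣n {K}) ⟨
      (K + r) % K   ≡⟨ x%K≡0 ⟩
      0             ∎
      where open ≡-Reasoning

  circNorm-neg : ∀ x y → (x + y) % K ≡ 0 → circNorm K x ≡ circNorm K y
  circNorm-neg x y x+y≡0 with %≡0⇒≡0⊎≡K r+s<2K r+s%K≡0
    where
    r+s<2K : x % K + y % K < K + K
    r+s<2K = +-mono-< (m%n<n x K) (m%n<n y K)
    r+s%K≡0 : (x % K + y % K) % K ≡ 0
    r+s%K≡0 = trans (sym (%-distribˡ-+ x y K)) x+y≡0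
  ... | inj₁ r+s≡0 rewrite circNorm≡ x | circNorm≡ y
        | m+n≡0⇒m≡0 (x % K) r+s≡0 | m+n≡0⇒n≡0 (x % K) r+s≡0 = refl
  ... | inj₂ r+s≡K = begin
    circNorm K x                  ≡⟨ circNorm≡ x ⟩
    r ⊓ (K ∸ r)                   ≡⟨ cong (λ z → r ⊓ (z ∸ r)) (sym r+s≡K) ⟩
    r ⊓ (r + s ∸ r)               ≡⟨ cong (r ⊓_) (m+n∸m≡n r s) ⟩
    r ⊓ s                         ≡⟨ ⊓-comm r s ⟩
    s ⊓ r                         ≡⟨ cong (s ⊓_) (m+n∸n≡m r s) ⟨
    s ⊓ (r + s ∸ s)               ≡⟨ cong (λ z → s ⊓ (z ∸ s)) r+s≡K ⟩
    s ⊓ (K ∸ s)                   ≡⟨ circNorm≡ y ⟨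
    circNorm K y                  ∎
    where
    open ≡-Reasoning
    r = x % K
    s = y % K

  ∣⇒≤circNorm : ∀ {d x} → d ∣ K → d ∣ x → x % K ≢ 0 → d ≤ circNorm K x
  ∣⇒≤circNorm {d} {x} d∣K d∣x r≢0 =
    ≤-circNorm⁺ (∣⇒≤ {{≢-nonZero r≢0}} d∣r) (∣⇒≤ {{≢-nonZero K∸r≢0}} d∣K∸r)
    where
    r = x % K
    d∣r : d ∣ r
    d∣r = %-presˡ-∣ d∣x d∣K
    d∣K∸r : d ∣ K ∸ r
    d∣K∸r = ∣m+n∣m⇒∣n (subst (d ∣_) (sym (m+[n∸m]≡n (m%n≤n x K))) d∣K) d∣r
    K∸r≢0 : K ∸ r ≢ 0
    K∸r≢0 = m<n⇒n≢0 (m<n⇒0<n∸m (m%n<n x K))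

  %-congˡ-+ : ∀ {x y} z → x % K ≡ y % K → (x + z) % K ≡ (y + z) % K
  %-congˡ-+ {x} {y} z x≡y = begin
    (x + z) % K             ≡⟨ %-distribˡ-+ x z K ⟩
    (x % K + z % K) % K     ≡⟨ cong (λ r → (r + z % K) % K) x≡y ⟩
    (y % K + z % K) % K     ≡⟨ %-distribˡ-+ y z K ⟨
    (y + z) % K             ∎
    where open ≡-Reasoning

  %-shift : ∀ a {b} t {u} → b ≤ K → (a + t) % K ≡ (b + u) % K → (a + (K ∸ b) + t) % K ≡ u % K
  %-shift a {b} t {u} b≤K eq = begin
    (a + (K ∸ b) + t) % K   ≡⟨ cong (_% K) (xy∙z≈xz∙y a (K ∸ b) t) ⟩
    (a + t + (K ∸ b)) % K   ≡⟨ %-congˡ-+ (K ∸ b) eq ⟩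
    (b + u + (K ∸ b)) % K   ≡⟨ cong (_% K) (xy∙z≈xz∙y b u (K ∸ b)) ⟩
    (b + (K ∸ b) + u) % K   ≡⟨ cong (λ z → (z + u) % K) (m+[n∸m]≡n b≤K) ⟩
    (K + u) % K             ≡⟨ %-remove-+ˡ u (n∣n {K}) ⟩
    u % K                   ∎
    where open ≡-Reasoning

  +-%-cancelˡ : ∀ {a t u} → a ≤ K → t < K → u < K → (a + t) % K ≡ (a + u) % K → t ≡ u
  +-%-cancelˡ {a} {t} {u} a≤K t<K u<K eq = begin
    t                       ≡⟨ m<n⇒m%n≡m t<K ⟨
    t % K                   ≡⟨ %-remove-+ˡ t (n∣n {K}) ⟨
    (K + t) % K             ≡⟨ cong (λ z → (z + t) % K) (m+[n∸m]≡n a≤K) ⟨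
    (a + (K ∸ a) + t) % K   ≡⟨ %-shift a t a≤K eq ⟩
    u % K                   ≡⟨ m<n⇒m%n≡m u<K ⟩
    u                       ∎
    where open ≡-Reasoning

  -- the residue r of a - b lies in [D, K - D], so r + t < K cannot wrap around to u < D
  circNorm-separated : ∀ {a b t u D} → b ≤ K → t < D → u < D →
    D ≤ circNorm K (a + (K ∸ b)) → (a + t) % K ≢ (b + u) % K
  circNorm-separated {a} {b} {t} {u} {D} b≤K t<D u<D sep eq =
    <⇒≱ u<D (≤-trans D≤r (≤-trans (m≤m+n r t) (≤-reflexive r+t≡u)))
    where
    x = a + (K ∸ b)
    r = x % K
    D≤r = proj₁ (≤-circNorm⁻ sep)
    D≤K∸r = proj₂ (≤-circNorm⁻ sep)
    r+t<K : r + t < K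
    r+t<K = <-≤-trans (+-monoʳ-< r t<D) (subst (r + D ≤_) (m+[n∸m]≡n (m%n≤n x K)) (+-monoʳ-≤ r D≤K∸r))
    r+t≡u : r + t ≡ u
    r+t≡u = begin
      r + t                 ≡⟨ m<n⇒m%n≡m r+t<K ⟨
      (r + t) % K           ≡⟨ %-congˡ-+ t (m%n%n≡m%n x K) ⟩
      (x + t) % K           ≡⟨ %-shift a t b≤K eq ⟩
      u % K                 ≡⟨ m<n⇒m%n≡m (<-≤-trans u<D (≤-trans D≤K∸r (m∸n≤m K r))) ⟩
      u                     ∎
      where open ≡-Reasoning

  [a+[K∸b]]%K≢0 : ∀ {a b} → a < K → b < K → a ≢ b → (a + (K ∸ b)) % K ≢ 0
  [a+[K∸b]]%K≢0 {a} {b} a<K b<K a≢b eq = a≢b (+-%-cancelˡ (m∸n≤m K b) a<K b<K (begin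
    ((K ∸ b) + a) % K       ≡⟨ cong (_% K) (+-comm (K ∸ b) a) ⟩
    (a + (K ∸ b)) % K       ≡⟨ eq ⟩
    0                       ≡⟨ n%n≡0 K ⟨
    K % K                   ≡⟨ cong (_% K) (m∸n+n≡m (<⇒≤ b<K)) ⟨
    ((K ∸ b) + b) % K       ∎))
    where open ≡-Reasoning

  [a+a]%K≢0 : ∀ {a} → 0 < a → a < K → a + a ≢ K → (a + a) % K ≢ 0
  [a+a]%K≢0 {a} 0<a a<K a+a≢K eq with %≡0⇒≡0⊎≡K (+-mono-< a<K a<K) eq
  ... | inj₁ a+a≡0 = m<n⇒n≢0 0<a (m+n≡0⇒m≡0 a a+a≡0)
  ... | inj₂ a+a≡K = a+a≢K a+a≡K

circNorm-half : ∀ d → circNorm (suc (d + d)) d ≡ d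
circNorm-half d = begin
  circNorm (suc (d + d)) d                          ≡⟨ circNorm≡ d ⟩
  d % suc (d + d) ⊓ (suc (d + d) ∸ d % suc (d + d)) ≡⟨ cong (λ r → r ⊓ (suc (d + d) ∸ r)) d%[1+d+d]≡d ⟩
  d ⊓ (suc d + d ∸ d)                               ≡⟨ cong (d ⊓_) (m+n∸n≡m (suc d) d) ⟩
  d ⊓ suc d                                         ≡⟨ m≤n⇒m⊓n≡m (n≤1+n d) ⟩
  d                                                 ∎
  where
  open ≡-Reasoning
  d%[1+d+d]≡d : d % suc (d + d) ≡ d
  d%[1+d+d]≡d = m≤n⇒m%n≡m (m≤m+n d d)

2∣n+n : ∀ n → 2 ∣ n + n
2∣n+n n = divides n (n+n≡n*2 n)
  where
  n+n≡n*2 : ∀ n → n + n ≡ n * 2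
  n+n≡n*2 = solve-∀

2∣⇒≢1+n+n : ∀ {m} n → 2 ∣ m → m ≢ suc (n + n)
2∣⇒≢1+n+n n 2∣m refl
  with () ← ∣1⇒≡1 (∣m+n∣m⇒∣n (subst (2 ∣_) (+-comm 1 (n + n)) 2∣m) (2∣n+n n))

+-double-injective : ∀ {m n} → m + m ≡ n + n → m ≡ n
+-double-injective {m} {n} eq = begin
  m               ≡⟨ n≡⌊n+n/2⌋ m ⟩
  ⌊ m + m /2⌋     ≡⟨ cong ⌊_/2⌋ eq ⟩
  ⌊ n + n /2⌋     ≡⟨ n≡⌊n+n/2⌋ n ⟨
  n               ∎
  where open ≡-Reasoning

∣a+[K∸b] : ∀ {d K a b e} → d ∣ K → d ∣ a + e → d ∣ b + e → b ≤ K → d ∣ a + (K ∸ b)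
∣a+[K∸b] {d} {K} {a} {b} {e} d∣K d∣a+e d∣b+e b≤K =
  ∣m+n∣m⇒∣n (subst (d ∣_) sum≡ (∣m∣n⇒∣m+n d∣a+e d∣K)) d∣b+e
  where
  rearrange : ∀ a b c e → (a + e) + (b + c) ≡ (b + e) + (a + c)
  rearrange = solve-∀
  sum≡ : (a + e) + K ≡ (b + e) + (a + (K ∸ b))
  sum≡ = trans (cong (_+_ (a + e)) (sym (m+[n∸m]≡n b≤K))) (rearrange a b (K ∸ b) e)

toℚᵘ-/ : ∀ i n → ℚ.toℚᵘ (i / suc n) ℚᵘ.≃ ℚᵘ.mkℚᵘ i n
toℚᵘ-/ i n = ℚ.toℚᵘ-fromℚᵘ (ℚᵘ.mkℚᵘ i n)

/≤/⇒*≤* : ∀ i n j m → i / suc n ℚ.≤ j / suc m → i ℤ.* + suc m ℤ.≤ j ℤ.* + suc n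
/≤/⇒*≤* i n j m h =
  ℚᵘ.drop-*≤* (ℚᵘ.≤-respˡ-≃ (toℚᵘ-/ i n) (ℚᵘ.≤-respʳ-≃ (toℚᵘ-/ j m) (ℚ.toℚᵘ-mono-≤ h)))

*≤*⇒/≤/ : ∀ i n j m → i ℤ.* + suc m ℤ.≤ j ℤ.* + suc n → i / suc n ℚ.≤ j / suc m
*≤*⇒/≤/ i n j m h = ℚ.toℚᵘ-cancel-≤
  (ℚᵘ.≤-respˡ-≃ (ℚᵘ.≃-sym (toℚᵘ-/ i n)) (ℚᵘ.≤-respʳ-≃ (ℚᵘ.≃-sym (toℚᵘ-/ j m)) (ℚᵘ.*≤* h)))

ℕ*≤*⇒/≤/ : ∀ a n b m → a * suc m ≤ b * suc n → + a / suc n ℚ.≤ + b / suc m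
ℕ*≤*⇒/≤/ a n b m h =
  *≤*⇒/≤/ (+ a) n (+ b) m (subst₂ ℤ._≤_ (ℤ.pos-* a (suc m)) (ℤ.pos-* b (suc n)) (+≤+ h))

opposite-*ˡ : ∀ s t → opposite (s Sign.* t) ≡ opposite s Sign.* t
opposite-*ˡ Sign.+ t = refl
opposite-*ˡ Sign.- t = Sign.opposite-involutive t

opposite-*ʳ : ∀ s t → opposite (s Sign.* t) ≡ s Sign.* opposite t
opposite-*ʳ Sign.+ t = refl
opposite-*ʳ Sign.- t = refl

*-solveˡ : ∀ s {t u} → s Sign.* t ≡ u → t ≡ s Sign.* u
*-solveˡ Sign.+ eq = eq
*-solveˡ Sign.- refl = sym (Sign.opposite-involutive _)

switchingSign : ∀ {n} → List (Fin n) → Fin n → Sign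
switchingSign []       v = Sign.+
switchingSign (u ∷ us) v = if ⌊ v Fin.≟ u ⌋ then opposite (switchingSign us v) else switchingSign us v

switchAll≡ : ∀ {n} (vs : List (Fin n)) σ {x y} → x ≢ y →
  switchAll vs σ x y ≡ switchingSign vs x Sign.* switchingSign vs y Sign.* σ x y
switchAll≡ []       σ x≢y = refl
switchAll≡ (u ∷ vs) σ {x} {y} x≢y with x Fin.≟ u | y Fin.≟ u
... | yes refl | yes refl = contradiction refl x≢y
... | yes _    | no _     = trans (cong opposite (switchAll≡ vs σ x≢y))
  (trans (opposite-*ˡ (εx Sign.* εy) (σ x y)) (cong (Sign._* σ x y) (opposite-*ˡ εx εy)))
  where εx = switchingSign vs x; εy = switchingSign vs y
... | no _     | yes _    = trans (cong opposite (switchAll≡ vs σ x≢y))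
  (trans (opposite-*ˡ (εx Sign.* εy) (σ x y)) (cong (Sign._* σ x y) (opposite-*ʳ εx εy)))
  where εx = switchingSign vs x; εy = switchingSign vs y
... | no _     | no _     = switchAll≡ vs σ x≢y

edge⇒≢ : ∀ {n} (G : SignedGraph n) {x y} → Edge G x y → x ≢ y
edge⇒≢ G {x} e refl with () ← trans (sym e) (adj-irrefl G x)

antibalanced-sig : ∀ {n} (G : SignedGraph n) vs → (∀ x y → Edge G x y → switchAll vs (sig G) x y ≡ Sign.-) →
  ∀ {x y} → Edge G x y → sig G x y ≡ switchingSign vs x Sign.* switchingSign vs y Sign.* Sign.-
antibalanced-sig G vs ab {x} {y} e =
  *-solveˡ (switchingSign vs x Sign.* switchingSign vs y)
    (trans (sym (switchAll≡ vs (sig G) (edge⇒≢ G e))) (ab x y e))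

-- switching at v corresponds to negating the colour of v, so one colour a and its negative suffice
antibalanced⇒coloring : ∀ {n} (G : SignedGraph n) {K D a} .{{_ : NonZero K}} → Antibalanced G →
  0 < a → a < K → D ≤ circNorm K (a + a) → Σ (Fin n → Fin K) (IsColoring G K D)
antibalanced⇒coloring G {K} {D} {a} (vs , ab) 0<a a<K D≤|2a| = colour ∘ ε , valid
  where
  ε = switchingSign vs
  value : Sign → ℕ
  value Sign.+ = a
  value Sign.- = K ∸ a
  value<K : ∀ s → value s < K
  value<K Sign.+ = a<K
  value<K Sign.- = ∸-monoʳ-< 0<a (<⇒≤ a<K)
  colour : Sign → Fin K
  colour s = fromℕ< (value<K s)
  |2a|≡|-2a| : circNorm K (a + a) ≡ circNorm K ((K ∸ a) + (K ∸ a))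
  |2a|≡|-2a| = circNorm-neg (a + a) _ (begin
    (a + a + ((K ∸ a) + (K ∸ a))) % K   ≡⟨ cong (_% K) (interchange a a (K ∸ a) (K ∸ a)) ⟩
    (a + (K ∸ a) + (a + (K ∸ a))) % K   ≡⟨ cong (λ z → (z + z) % K) (m+[n∸m]≡n (<⇒≤ a<K)) ⟩
    (K + K) % K                         ≡⟨ %-remove-+ˡ K (n∣n {K}) ⟩
    K % K                               ≡⟨ n%n≡0 K ⟩
    0                                   ∎)
    where open ≡-Reasoning
  edge-valid : ∀ s t → D ≤ circNorm K (diffRep K (s Sign.* t Sign.* Sign.-) (value s) (value t))
  edge-valid Sign.+ Sign.+ = D≤|2a|
  edge-valid Sign.+ Sign.- = subst (λ z → D ≤ circNorm K (a + z)) (sym (m∸[m∸n]≡n (<⇒≤ a<K))) D≤|2a|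
  edge-valid Sign.- Sign.+ = subst (D ≤_) |2a|≡|-2a| D≤|2a|
  edge-valid Sign.- Sign.- = subst (D ≤_) |2a|≡|-2a| D≤|2a|
  valid : IsColoring G K D (colour ∘ ε)
  valid x y e rewrite Fin.toℕ-fromℕ< (value<K (ε x)) | Fin.toℕ-fromℕ< (value<K (ε y))
    | antibalanced-sig G vs ab e = edge-valid (ε x) (ε y)

2-coloring⇒bipartite : ∀ {n} (G : SignedGraph n) {c} → IsColoring G 2 1 c → Bipartite G
2-coloring⇒bipartite G {c} valid = isZero ∘ c , λ x y e → differ (sig G x y) (c x) (c y) (valid x y e)
  where
  isZero : Fin 2 → Bool
  isZero Fin.zero           = true
  isZero (Fin.suc Fin.zero) = false
  differ : ∀ s a b → 1 ≤ circNorm 2 (diffRep 2 s (toℕ a) (toℕ b)) → isZero a ≢ isZero b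
  differ _      Fin.zero           (Fin.suc Fin.zero) _ ()
  differ _      (Fin.suc Fin.zero) Fin.zero           _ ()
  differ Sign.+ Fin.zero           Fin.zero           ()
  differ Sign.- Fin.zero           Fin.zero           ()
  differ Sign.+ (Fin.suc Fin.zero) (Fin.suc Fin.zero) ()
  differ Sign.- (Fin.suc Fin.zero) (Fin.suc Fin.zero) ()

halve : ∀ {p n} → p + p ≤ suc (n + n) → p ≤ n
halve {zero}  _ = z≤n
halve {suc p} {zero} (s≤s p+1+p≤0) with () ← subst (_≤ 0) (+-suc p p) p+1+p≤0
halve {suc p} {suc n} (s≤s h) = s≤s (halve (s≤s⁻¹ (subst₂ _≤_ (+-suc p p) (cong suc (+-suc n n)) h)))

numerator-bound : ∀ p m .{{_ : NonZero m}} →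
  p ℤ.* + (m + m) ℤ.≤ + suc (m + m + (m + m)) ℤ.* + m → p ℤ.* + 1 ℤ.≤ + 2 ℤ.* + m
numerator-bound -[1+ p ] m _ = subst₂ ℤ._≤_ (sym (ℤ.*-identityʳ -[1+ p ])) (ℤ.pos-* 2 m) ℤ.-≤+
numerator-bound (+ p) m h =
  subst₂ ℤ._≤_ (ℤ.pos-* p 1) (ℤ.pos-* 2 m) (+≤+ (subst₂ _≤_ (sym (*-identityʳ p)) (double m) p≤m+m))
  where
  double : ∀ m → m + m ≡ 2 * m
  double = solve-∀
  regroup : ∀ p m → p * (m + m) ≡ (p + p) * m
  regroup = solve-∀
  2p*m≤[4m+1]*m : (p + p) * m ≤ suc (m + m + (m + m)) * m
  2p*m≤[4m+1]*m = subst (_≤ suc (m + m + (m + m)) * m) (regroup p m)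
    (ℤ.drop‿+≤+ {p * (m + m)}
      (subst₂ ℤ._≤_ (sym (ℤ.pos-* p (m + m))) (sym (ℤ.pos-* (suc (m + m + (m + m))) m)) h))
  p≤m+m : p ≤ m + m
  p≤m+m = halve {p} {m + m} (*-cancelʳ-≤ (p + p) (suc (m + m + (m + m))) m 2p*m≤[4m+1]*m)

circRatio≥2 : ∀ {n} (G : SignedGraph n) {r} → CircRatio G r → + 2 / 1 ℚ.≤ r
circRatio≥2 G (K , d , (_ , 2D≤K , _) , refl) =
  ℕ*≤*⇒/≤/ 2 0 K d (subst (2 * suc d ≤_) (sym (*-identityʳ K)) 2D≤K)

module _ {n} (G : SignedGraph n) (antibalanced : Antibalanced G) where

  antibalanced-χ : ¬ Bipartite G → IsChromaticNumber G 3
  antibalanced-χ nonbipartite =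
    (≤-refl , s≤s (s≤s z≤n) , antibalanced⇒coloring G antibalanced z<s (s≤s (s≤s z≤n)) ≤-refl) , minimal
    where
    minimal : ∀ K → HasColoring G K 1 → 3 ≤ K
    minimal 0                   (_ , ()     , _)
    minimal 1                   (_ , s≤s () , _)
    minimal 2                   (_ , _ , _ , valid) = contradiction (2-coloring⇒bipartite G valid) nonbipartite
    minimal (suc (suc (suc _))) _ = s≤s (s≤s (s≤s z≤n))

  antibalanced-χc : IsCircularChromaticNumber G (+ 2 / 1)
  antibalanced-χc = (λ _ → circRatio≥2 G) , upper
    where
    -- b = p/m is below the ratio (4m+1)/(2m) of the colouring by ±m, and numerator-bound gives p ≤ 2m
    upper : ∀ b → (∀ r → CircRatio G r → b ℚ.≤ r) → b ℚ.≤ + 2 / 1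
    upper b lower = subst (ℚ._≤ + 2 / 1) (ℚ.↥p/↧p≡p b)
      (*≤*⇒/≤/ (↥ b) _ (+ 2) 0 (numerator-bound (↥ b) m (/≤/⇒*≤* (↥ b) _ (+ K) _ b≤K/D)))
      where
      m = ℚ.↧ₙ b
      D = m + m
      K = suc (D + D)
      coloring : HasColoring G K D
      coloring = s≤s z≤n , subst (_≤ K) (cong (_+_ D) (sym (+-identityʳ D))) (n≤1+n (D + D)) ,
        antibalanced⇒coloring G antibalanced z<s (s≤s (≤-trans (m≤m+n m m) (m≤m+n D D)))
          (≤-reflexive (sym (circNorm-half D)))
      b≤K/D : ↥ b / m ℚ.≤ + K / D
      b≤K/D = subst (ℚ._≤ + K / D) (sym (ℚ.↥p/↧p≡p b)) (lower _ (K , _ , coloring , refl))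

-- Circular cliques

clique-bound : ∀ {k K D} .{{_ : NonZero K}} (c : Fin k → Fin K) → D ≤ K →
  (∀ {i j} → i ≢ j → D ≤ circNorm K (toℕ (c i) + (K ∸ toℕ (c j)))) → k * D ≤ K
clique-bound {k} {K} {D} c D≤K separated = Fin.injective⇒≤ {f = f ∘ remQuot D} (remQuot-injective ∘ f-injective)
  where
  f : Fin k × Fin D → Fin K
  f (i , t) = (toℕ (c i) + toℕ t) mod K
  toℕ-f : ∀ p → toℕ (f p) ≡ (toℕ (c (proj₁ p)) + toℕ (proj₂ p)) % K
  toℕ-f _ = Fin.toℕ-fromℕ< _
  <K : (t : Fin D) → toℕ t < K
  <K t = <-≤-trans (Fin.toℕ<n t) D≤K
  f-injective : ∀ {p q} → f p ≡ f q → p ≡ q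
  f-injective {i , t} {j , u} eq with i Fin.≟ j
  ... | yes refl = cong (i ,_) (Fin.toℕ-injective (+-%-cancelˡ (<⇒≤ (Fin.toℕ<n (c i))) (<K t) (<K u) eq%))
    where eq% = trans (sym (toℕ-f (i , t))) (trans (cong toℕ eq) (toℕ-f (i , u)))
  ... | no i≢j = contradiction eq%
    (circNorm-separated (<⇒≤ (Fin.toℕ<n (c j))) (Fin.toℕ<n t) (Fin.toℕ<n u) (separated i≢j))
    where eq% = trans (sym (toℕ-f (i , t))) (trans (cong toℕ eq) (toℕ-f (j , u)))
  remQuot-injective : ∀ {x y} → remQuot {k} D x ≡ remQuot D y → x ≡ y
  remQuot-injective {x} {y} eq = trans (sym (Fin.combine-remQuot {k} D x))
    (trans (cong (uncurry combine) eq) (Fin.combine-remQuot {k} D y))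

injective⇒surjective : ∀ {k} (g : Fin k → Fin k) → (∀ {i j} → g i ≡ g j → i ≡ j) →
  ∀ y → ∃ λ i → g i ≡ y
injective⇒surjective {k} g g-injective y with Fin.pigeonhole (n<1+n k) g′
  where
  g′ : Fin (suc k) → Fin k
  g′ Fin.zero    = y
  g′ (Fin.suc i) = g i
... | Fin.zero  , Fin.suc j , _   , y≡gj  = j , sym y≡gj
... | Fin.suc i , Fin.suc j , i<j , gi≡gj = contradiction (cong (suc ∘ toℕ) (g-injective gi≡gj)) (<⇒≢ i<j)

-- The twin clique: v i = inj₁ i and w i = inj₂ i
module TwinClique (k : ℕ) where

  Vertex : Set
  Vertex = Fin k ⊎ Fin k

  twinAdj : Vertex → Vertex → Bool
  twinAdj (inj₁ i) (inj₁ j) = not ⌊ i Fin.≟ j ⌋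
  twinAdj (inj₁ _) (inj₂ _) = true
  twinAdj (inj₂ _) (inj₁ _) = true
  twinAdj (inj₂ _) (inj₂ _) = false

  twinSig : Vertex → Vertex → Sign
  twinSig (inj₁ i) (inj₂ j) = if ⌊ i Fin.≟ j ⌋ then Sign.- else Sign.+
  twinSig (inj₂ j) (inj₁ i) = if ⌊ i Fin.≟ j ⌋ then Sign.- else Sign.+
  twinSig _        _        = Sign.+

  twinAdj-sym : ∀ p q → twinAdj p q ≡ twinAdj q p
  twinAdj-sym (inj₁ i) (inj₁ j) with i Fin.≟ j | j Fin.≟ i
  ... | yes _   | yes _   = refl
  ... | no _    | no _    = refl
  ... | yes i≡j | no j≢i  = contradiction (sym i≡j) j≢i
  ... | no i≢j  | yes j≡i = contradiction (sym j≡i) i≢j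
  twinAdj-sym (inj₁ _) (inj₂ _) = refl
  twinAdj-sym (inj₂ _) (inj₁ _) = refl
  twinAdj-sym (inj₂ _) (inj₂ _) = refl

  twinAdj-irrefl : ∀ p → twinAdj p p ≡ false
  twinAdj-irrefl (inj₁ i) with i Fin.≟ i
  ... | yes _   = refl
  ... | no i≢i  = contradiction refl i≢i
  twinAdj-irrefl (inj₂ _) = refl

  twinSig-sym : ∀ p q → twinSig p q ≡ twinSig q p
  twinSig-sym (inj₁ _) (inj₁ _) = refl
  twinSig-sym (inj₁ _) (inj₂ _) = refl
  twinSig-sym (inj₂ _) (inj₁ _) = refl
  twinSig-sym (inj₂ _) (inj₂ _) = refl

  twinClique : SignedGraph (k + k)
  twinClique = record
    { adj        = λ x y → twinAdj (splitAt k x) (splitAt k y)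
    ; adj-sym    = λ x y → twinAdj-sym (splitAt k x) (splitAt k y)
    ; adj-irrefl = λ x → twinAdj-irrefl (splitAt k x)
    ; sig        = λ x y → twinSig (splitAt k x) (splitAt k y)
    ; sig-sym    = λ x y → twinSig-sym (splitAt k x) (splitAt k y)
    }

  TwinColoring : (K D : ℕ) → (Vertex → Fin K) → Set
  TwinColoring K D c = ∀ p q → twinAdj p q ≡ true →
    D ≤ circNorm K (diffRep K (twinSig p q) (toℕ (c p)) (toℕ (c q)))

  TwinColoring⇒IsColoring : ∀ {K D c} → TwinColoring K D c → IsColoring twinClique K D (c ∘ splitAt k)
  TwinColoring⇒IsColoring valid x y = valid (splitAt k x) (splitAt k y)

  IsColoring⇒TwinColoring : ∀ {K D c} → IsColoring twinClique K D c → TwinColoring K D (c ∘ join k k)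
  IsColoring⇒TwinColoring valid p q with valid (join k k p) (join k k q)
  ... | valid-pq rewrite Fin.splitAt-join k k p | Fin.splitAt-join k k q = valid-pq

  diagonal-coloring : ∀ {K D} (f : Fin k → Fin K) →
    (∀ {i j} → i ≢ j → D ≤ circNorm K (toℕ (f i) + (K ∸ toℕ (f j)))) →
    (∀ i → D ≤ circNorm K (toℕ (f i) + toℕ (f i))) →
    TwinColoring K D [ f , f ]′
  diagonal-coloring f positive negative (inj₁ i) (inj₁ j) e with i Fin.≟ j
  ... | no i≢j = positive i≢j
  diagonal-coloring f positive negative (inj₁ i) (inj₂ j) _ with i Fin.≟ j
  ... | yes refl = negative i
  ... | no i≢j   = positive i≢j
  diagonal-coloring f positive negative (inj₂ j) (inj₁ i) _ with i Fin.≟ j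
  ... | yes refl = negative i
  ... | no i≢j   = positive (i≢j ∘ sym)

  module _ {K D c} (valid : TwinColoring K D c) where

    clique-separated : ∀ {i j} → i ≢ j → D ≤ circNorm K (toℕ (c (inj₁ i)) + (K ∸ toℕ (c (inj₁ j))))
    clique-separated {i} {j} i≢j with i Fin.≟ j | valid (inj₁ i) (inj₁ j)
    ... | yes i≡j | _       = contradiction i≡j i≢j
    ... | no _    | valid-ij = valid-ij refl

    twin-separated : ∀ {i j} → i ≢ j → D ≤ circNorm K (toℕ (c (inj₂ j)) + (K ∸ toℕ (c (inj₁ i))))
    twin-separated {i} {j} i≢j with i Fin.≟ j | valid (inj₂ j) (inj₁ i)
    ... | yes i≡j | _       = contradiction i≡j i≢j
    ... | no _    | valid-ji = valid-ji refl

    twin-negative : ∀ i → D ≤ circNorm K (toℕ (c (inj₁ i)) + toℕ (c (inj₂ i)))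
    twin-negative i with i Fin.≟ i | valid (inj₁ i) (inj₂ i)
    ... | yes _   | valid-ii = valid-ii refl
    ... | no i≢i  | _        = contradiction refl i≢i

    clique-injective : .{{_ : NonZero K}} → 1 ≤ D → ∀ {i j} → c (inj₁ i) ≡ c (inj₁ j) → i ≡ j
    clique-injective 1≤D {i} {j} vi≡vj with i Fin.≟ j
    ... | yes i≡j = i≡j
    ... | no i≢j = contradiction
      (≤-trans 1≤D (subst (λ z → D ≤ circNorm K (toℕ z + (K ∸ toℕ (c (inj₁ j))))) vi≡vj (clique-separated i≢j)))
      (¬1≤circNorm[a+[K∸a]] (<⇒≤ (Fin.toℕ<n (c (inj₁ j)))))

    twin-clique-bound : .{{_ : NonZero K}} → D ≤ K → k * D ≤ K
    twin-clique-bound D≤K = clique-bound (c ∘ inj₁) D≤K clique-separated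

  no-coloring-with-k-colours : .{{_ : NonZero k}} → ∀ {c} → ¬ TwinColoring k 1 c
  no-coloring-with-k-colours {c} valid
    with i , vi≡0 ← injective⇒surjective (c ∘ inj₁) (clique-injective {k} {1} valid ≤-refl) (fromℕ< (>-nonZero⁻¹ k))
    with j , vj≡wi ← injective⇒surjective (c ∘ inj₁) (clique-injective {k} {1} valid ≤-refl) (c (inj₂ i))
    with j Fin.≟ i
  ... | yes refl =
    %≡0⇒¬1≤circNorm (trans (cong (_% k) vi+wi≡0) (m<n⇒m%n≡m (>-nonZero⁻¹ k))) (twin-negative {k} {1} valid i)
    where
    vi+wi≡0 : toℕ (c (inj₁ i)) + toℕ (c (inj₂ i)) ≡ 0
    vi+wi≡0 rewrite sym vj≡wi | vi≡0 | Fin.toℕ-fromℕ< (>-nonZero⁻¹ k) = refl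
  ... | no j≢i = ¬1≤circNorm[a+[K∸a]] (<⇒≤ (Fin.toℕ<n (c (inj₂ i))))
    (subst (λ z → 1 ≤ circNorm k (toℕ (c (inj₂ i)) + (k ∸ toℕ z))) vj≡wi (twin-separated {k} {1} valid j≢i))

module _ {k} .{{_ : NonZero k}} (2∣k : 2 ∣ k) where
  open TwinClique k

  instance
    k+k-nonZero : NonZero (k + k)
    k+k-nonZero = >-nonZero (≤-trans (>-nonZero⁻¹ k) (m≤m+n k k))

  successor-coloring : TwinColoring (suc k) 1 [ Fin.suc , Fin.suc ]′
  successor-coloring = diagonal-coloring Fin.suc distinct double
    where
    distinct : ∀ {i j} → i ≢ j → 1 ≤ circNorm (suc k) (suc (toℕ i) + (suc k ∸ suc (toℕ j)))
    distinct {i} {j} i≢j = ∣⇒≤circNorm (1∣ suc k) (1∣ (suc (toℕ i) + (suc k ∸ suc (toℕ j))))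
      ([a+[K∸b]]%K≢0 (s≤s (Fin.toℕ<n i)) (s≤s (Fin.toℕ<n j)) (i≢j ∘ Fin.toℕ-injective ∘ suc-injective))
    double : ∀ i → 1 ≤ circNorm (suc k) (suc (toℕ i) + suc (toℕ i))
    double i = ∣⇒≤circNorm (1∣ suc k) (1∣ (suc (toℕ i) + suc (toℕ i))) ([a+a]%K≢0 z<s (s≤s (Fin.toℕ<n i))
      (λ eq → 2∣⇒≢1+n+n (toℕ i) 2∣k (trans (sym (suc-injective eq)) (+-suc (toℕ i) (toℕ i)))))

  odd< : (i : Fin k) → suc (toℕ i + toℕ i) < k + k
  odd< i = subst (_≤ k + k) (cong suc (+-suc (toℕ i) (toℕ i))) (+-mono-≤ (Fin.toℕ<n i) (Fin.toℕ<n i))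

  odd : Fin k → Fin (k + k)
  odd i = fromℕ< (odd< i)

  odd-coloring : TwinColoring (k + k) 2 [ odd , odd ]′
  odd-coloring = diagonal-coloring odd distinct double
    where
    2∣odd+1 : ∀ n → 2 ∣ suc (n + n) + 1
    2∣odd+1 n = divides (suc n) (odd+1≡ n)
      where
      odd+1≡ : ∀ n → suc (n + n) + 1 ≡ suc n * 2
      odd+1≡ = solve-∀
    distinct : ∀ {i j} → i ≢ j → 2 ≤ circNorm (k + k) (toℕ (odd i) + (k + k ∸ toℕ (odd j)))
    distinct {i} {j} i≢j rewrite Fin.toℕ-fromℕ< (odd< i) | Fin.toℕ-fromℕ< (odd< j) =
      ∣⇒≤circNorm (2∣n+n k) (∣a+[K∸b] (2∣n+n k) (2∣odd+1 (toℕ i)) (2∣odd+1 (toℕ j)) (<⇒≤ (odd< j)))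
        ([a+[K∸b]]%K≢0 (odd< i) (odd< j) (i≢j ∘ Fin.toℕ-injective ∘ +-double-injective ∘ suc-injective))
    double : ∀ i → 2 ≤ circNorm (k + k) (toℕ (odd i) + toℕ (odd i))
    double i rewrite Fin.toℕ-fromℕ< (odd< i) = ∣⇒≤circNorm (2∣n+n k) (2∣n+n (suc (toℕ i + toℕ i)))
      ([a+a]%K≢0 z<s (odd< i) (λ eq → 2∣⇒≢1+n+n (toℕ i) 2∣k (sym (+-double-injective eq))))

  twinClique-χ : IsChromaticNumber twinClique (suc k)
  twinClique-χ =
    (≤-refl , s≤s (>-nonZero⁻¹ k) , _ , TwinColoring⇒IsColoring {suc k} {1} successor-coloring) , minimal
    where
    minimal : ∀ K → HasColoring twinClique K 1 → suc k ≤ K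
    minimal 0       (_ , () , _)
    minimal (suc K) (_ , _ , _ , valid) = ≤∧≢⇒< k≤K k≢K
      where
      k≤K : k ≤ suc K
      k≤K = subst (_≤ suc K) (*-identityʳ k)
        (twin-clique-bound {suc K} {1} (IsColoring⇒TwinColoring valid) (s≤s z≤n))
      k≢K : k ≢ suc K
      k≢K refl = no-coloring-with-k-colours (IsColoring⇒TwinColoring {k} {1} valid)

  twinClique-χc : 2 ≤ k → IsCircularChromaticNumber twinClique (+ k / 1)
  twinClique-χc 2≤k = lower , upper
    where
    lower : ∀ r → CircRatio twinClique r → + k / 1 ℚ.≤ r
    lower _ (0     , _ , (_ , ()     , _)         , refl)
    lower _ (suc K , d , (_ , 2D≤K , _ , valid) , refl) = ℕ*≤*⇒/≤/ k 0 (suc K) d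
      (subst (k * suc d ≤_) (sym (*-identityʳ (suc K)))
        (twin-clique-bound {suc K} {suc d} (IsColoring⇒TwinColoring valid) (≤-trans (m≤m+n (suc d) _) 2D≤K)))
    upper : ∀ b → (∀ r → CircRatio twinClique r → b ℚ.≤ r) → b ℚ.≤ + k / 1
    upper b lower-bound = ℚ.≤-trans (lower-bound _ (k + k , 1 , coloring , refl))
      (ℕ*≤*⇒/≤/ (k + k) 1 k 0 (≤-reflexive (2k≡ k)))
      where
      coloring : HasColoring twinClique (k + k) 2
      coloring = s≤s z≤n , +-mono-≤ 2≤k 2≤k , _ , TwinColoring⇒IsColoring {k + k} {2} odd-coloring
      2k≡ : ∀ k → (k + k) * 1 ≡ k * 2
      2k≡ = solve-∀

theorem16 : (∀ n (G : SignedGraph n) → Antibalanced G → ¬ Bipartite G →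
    IsChromaticNumber G 3 × IsCircularChromaticNumber G ((+ 2) / 1))
    ×
    (∀ k → 2 ∣ k → 2 ≤ k →
    ∃ λ n → ∃ λ (G : SignedGraph n) →
    IsChromaticNumber G (suc k) × IsCircularChromaticNumber G ((+ k) / 1))
theorem16 =
  (λ n G antibalanced nonbipartite →
     antibalanced-χ G antibalanced nonbipartite , antibalanced-χc G antibalanced) ,
  λ { zero _ ()
    ; k@(suc _) 2∣k 2≤k → k + k , TwinClique.twinClique k , twinClique-χ 2∣k , twinClique-χc 2∣k 2≤k
    }
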